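{- For any finite set $D$ of positive integers, the packing chromatic number $\chi_{\rho}(G(\mathbb{Z},D))$ is finite.
   Context: For a graph $G$, a packing $k$-coloring is a map $f:V(G)\to\{1,\ldots,k\}$ such that any two distinct vertices $u,v$ with $f(u)=f(v)=i$ satisfy $d_G(u,v)\geq i+1$. The packing chromatic number $\chi_{\rho}(G)$ is the least $k$ for which a packing $k$-coloring exists (infinite if none exists for any finite $k$). For a set $D$ of positive integers, the distance graph $G(\mathbb{Z},D)$ has vertex set $\mathbb{Z}$, two distinct integers $i,j$ being adjacent iff $|i-j|\in D$. -}

module Defs where

open import Data.Nat using (ℕ; zero; suc; _≤_; _<_)
open import Data.Integer using (ℤ; +_; _+_; _-_)
open import Data.List using (List)
open import Data.List.Membership.Propositional using (_∈_)
open import Data.List.Relation.Unary.All using (All)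
open import Data.Product using (Σ; ∃; _×_)
open import Data.Sum using (_⊎_)
open import Relation.Binary.PropositionalEquality using (_≡_)
open import Relation.Nullary using (¬_)

PositiveSet : List ℕ → Set
PositiveSet D = All (λ d → 0 < d) D

-- Adjacency in the distance graph G(ℤ, D): i ~ j iff |i - j| ∈ D.
-- (Positivity of D makes i ≠ j automatic.)
Adj : List ℕ → ℤ → ℤ → Set
Adj D i j = ∃ λ d → d ∈ D × ((j ≡ i + (+ d)) ⊎ (j ≡ i - (+ d)))

data Walk (D : List ℕ) : ℤ → ℤ → ℕ → Set where
  here : ∀ {u} → Walk D u u zero
  step : ∀ {u w v n} → Adj D u w → Walk D w v n → Walk D u v (suc n)

-- d_G(u,v) ≥ m : there is no walk from u to v of length < m
-- (vertices in different components have distance ∞).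
DistGE : List ℕ → ℤ → ℤ → ℕ → Set
DistGE D u v m = ∀ n → n < m → ¬ Walk D u v n

IsPackingColoring : List ℕ → ℕ → (ℤ → ℕ) → Set
IsPackingColoring D k f =
  (∀ u → 1 ≤ f u × f u ≤ k) ×
  (∀ u v → ¬ u ≡ v → f u ≡ f v → DistGE D u v (suc (f u)))

PackingChromaticFinite : List ℕ → Set
PackingChromaticFinite D = ∃ λ k → ∃ λ f → IsPackingColoring D k f

module Submission where

-- Let every element of D be at most B.  An edge moves a vertex by at most
-- B, so a walk of length n joins vertices with |u - v| ≤ n·B
-- ('walk-displacement').
--
-- Fix a period L > 0 and write u = r + q·L with 0 ≤ r < L (the level of u)
-- and q = s + k·2^r with 0 ≤ s < 2^r (the offset of u).  Colour u with
-- 2^r + s.  This number lies in [2^r, 2^(r+1)), so it determines r and then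
-- s; hence equally coloured vertices agree modulo 2^r·L, and distinct ones
-- are at least 2^r·L apart ('same-colour-apart').  All colours lie in
-- [1, 2^L].
--
-- With L = 2(B+1), a walk of length n ≤ c < 2^(r+1) between two distinct
-- vertices of colour c would give |u - v| ≤ n(B+1) < 2^r·L, which is
-- impossible; so the colouring is a packing 2^L-colouring.  For the theorem
-- take B = max D.

open import Defs
open import Data.Nat using (ℕ)
open import Data.List using (List)

open import Data.Nat as ℕ using (suc; NonZero; _^_; _≤_; _<_; z≤n)
import Data.Nat.Properties as ℕP
open import Data.Nat.Divisibility using (divides; ∣⇒≤)
open import Data.Nat.Tactic.RingSolver as ℕSolver using ()
open import Data.Integer using (ℤ; +_; ∣_∣; _+_; _-_; _*_; -_)
import Data.Integer.Properties as ℤP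
open import Data.Integer.DivMod using (_/ℕ_; _%ℕ_; a≡a%ℕn+[a/ℕn]*n; n%ℕd<d)
open import Data.Integer.Tactic.RingSolver as ℤSolver using ()
open import Data.List.Extrema.Nat using (max; xs≤max)
open import Data.List.Membership.Propositional using (_∈_)
import Data.List.Relation.Unary.All as All
open import Data.Product using (_,_; _×_)
open import Data.Sum using (_⊎_; inj₁; inj₂)
open import Relation.Binary.Definitions using (tri<; tri≈; tri>)
open import Relation.Nullary using (¬_; contradiction)
open import Relation.Binary.PropositionalEquality

edge-length : ∀ u w d → (w ≡ u + + d) ⊎ (w ≡ u - + d) → ∣ w - u ∣ ≡ d
edge-length u w d (inj₁ refl) = cong ∣_∣ (shift-back u (+ d))
  where
  shift-back : ∀ a b → (a + b) - a ≡ b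
  shift-back = ℤSolver.solve-∀
edge-length u w d (inj₂ refl) = trans (cong ∣_∣ (shift-back u (+ d))) (ℤP.∣-i∣≡∣i∣ (+ d))
  where
  shift-back : ∀ a b → (a - b) - a ≡ - b
  shift-back = ℤSolver.solve-∀

walk-displacement : ∀ {D B u v n} → (∀ {d} → d ∈ D → d ≤ B) →
                    Walk D u v n → ∣ v - u ∣ ≤ n ℕ.* B
walk-displacement {u = u} bounded here rewrite ℤP.+-inverseʳ u = z≤n
walk-displacement {B = B} {u} {v} bounded (step {w = w} {n = n} (d , d∈D , w≈u±d) walk) =
  begin
    ∣ v - u ∣                 ≡⟨ cong ∣_∣ (sym (split-difference v w u)) ⟩
    ∣ (v - w) + (w - u) ∣     ≤⟨ ℤP.∣i+j∣≤∣i∣+∣j∣ (v - w) (w - u) ⟩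
    ∣ v - w ∣ ℕ.+ ∣ w - u ∣   ≤⟨ ℕP.+-mono-≤ (walk-displacement bounded walk) first-edge ⟩
    n ℕ.* B ℕ.+ B             ≡⟨ ℕP.+-comm (n ℕ.* B) B ⟩
    suc n ℕ.* B               ∎
  where
  open ℕP.≤-Reasoning
  split-difference : ∀ a b c → (a - b) + (b - c) ≡ a - c
  split-difference = ℤSolver.solve-∀
  first-edge : ∣ w - u ∣ ≤ B
  first-edge = subst (_≤ B) (sym (edge-length u w d w≈u±d)) (bounded d∈D)

multiple-apart : ∀ u v m k → ¬ u ≡ v → u - v ≡ k * + m → m ≤ ∣ u - v ∣
multiple-apart u v m k u≢v u-v≡km = ∣⇒≤ {{ℕ.≢-nonZero ∣u-v∣≢0}} (divides ∣ k ∣ ∣u-v∣≡∣k∣m)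
  where
  ∣u-v∣≡∣k∣m : ∣ u - v ∣ ≡ ∣ k ∣ ℕ.* m
  ∣u-v∣≡∣k∣m = trans (cong ∣_∣ u-v≡km) (ℤP.abs-* k (+ m))
  ∣u-v∣≢0 : ∣ u - v ∣ ≢ 0
  ∣u-v∣≢0 eq = u≢v (ℤP.i-j≡0⇒i≡j u v (ℤP.∣i∣≡0⇒i≡0 eq))

below-next-power : ∀ r s → s < 2 ^ r → 2 ^ r ℕ.+ s < 2 ^ suc r
below-next-power r s s<2^r =
  subst (2 ^ r ℕ.+ s <_) (cong (2 ^ r ℕ.+_) (sym (ℕP.+-identityʳ (2 ^ r))))
        (ℕP.+-monoʳ-< (2 ^ r) s<2^r)

leading-exponent-< : ∀ r r' s s' → s < 2 ^ r → r < r' → 2 ^ r ℕ.+ s < 2 ^ r' ℕ.+ s'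
leading-exponent-< r r' s s' s<2^r r<r' = ℕP.<-≤-trans (below-next-power r s s<2^r)
  (ℕP.≤-trans (ℕP.^-monoʳ-≤ 2 r<r') (ℕP.m≤m+n (2 ^ r') s'))

leading-exponent-unique : ∀ r r' s s' → s < 2 ^ r → s' < 2 ^ r' →
                          2 ^ r ℕ.+ s ≡ 2 ^ r' ℕ.+ s' → r ≡ r'
leading-exponent-unique r r' s s' s<2^r s'<2^r' eq with ℕP.<-cmp r r'
... | tri≈ _ r≡r' _ = r≡r'
... | tri< r<r' _ _ = contradiction eq (ℕP.<⇒≢ (leading-exponent-< r r' s s' s<2^r r<r'))
... | tri> _ _ r'<r = contradiction (sym eq) (ℕP.<⇒≢ (leading-exponent-< r' r s' s s'<2^r' r'<r))

-- The colouring with period L: the colour of u encodes its residue r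
-- modulo L (as the leading binary digit 2^r) and the next digit of u in
-- radix 2^r.
module Colouring (L : ℕ) .{{_ : NonZero L}} where

  level : ℤ → ℕ
  level u = u %ℕ L

  block : ℤ → ℤ
  block u = u /ℕ L

  radix-nonZero : ∀ u → NonZero (2 ^ level u)
  radix-nonZero u = ℕP.m^n≢0 2 (level u)

  offset : ℤ → ℕ
  offset u = _%ℕ_ (block u) (2 ^ level u) {{radix-nonZero u}}

  cycle : ℤ → ℤ
  cycle u = _/ℕ_ (block u) (2 ^ level u) {{radix-nonZero u}}

  colour : ℤ → ℕ
  colour u = 2 ^ level u ℕ.+ offset u

  expansion : ∀ u → u ≡ + level u + (+ offset u + cycle u * + 2 ^ level u) * + L
  expansion u = trans (a≡a%ℕn+[a/ℕn]*n u L)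
                      (cong (λ q → + level u + q * + L) (a≡a%ℕn+[a/ℕn]*n (block u) (2 ^ level u) {{radix-nonZero u}}))

  level<L : ∀ u → level u < L
  level<L u = n%ℕd<d u L

  offset<2^level : ∀ u → offset u < 2 ^ level u
  offset<2^level u = n%ℕd<d (block u) (2 ^ level u) {{radix-nonZero u}}

  colour<2^[1+level] : ∀ u → colour u < 2 ^ suc (level u)
  colour<2^[1+level] u = below-next-power (level u) (offset u) (offset<2^level u)

  colour-range : ∀ u → 1 ≤ colour u × colour u ≤ 2 ^ L
  colour-range u =
    ℕP.≤-trans (ℕP.m^n>0 2 (level u)) (ℕP.m≤m+n (2 ^ level u) (offset u)) ,
    ℕP.≤-trans (ℕP.<⇒≤ (colour<2^[1+level] u)) (ℕP.^-monoʳ-≤ 2 (level<L u))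

  colour-determines-level : ∀ u v → colour u ≡ colour v → level u ≡ level v
  colour-determines-level u v =
    leading-exponent-unique (level u) (level v) (offset u) (offset v)
                            (offset<2^level u) (offset<2^level v)

  colour-determines-offset : ∀ u v → colour u ≡ colour v → offset u ≡ offset v
  colour-determines-offset u v same =
    ℕP.+-cancelˡ-≡ (2 ^ level u) (offset u) (offset v)
      (trans same (cong (λ r → 2 ^ r ℕ.+ offset v) (sym (colour-determines-level u v same))))

  same-colour-congruent : ∀ u v → colour u ≡ colour v →
                          u - v ≡ (cycle u - cycle v) * + (2 ^ level u ℕ.* L)
  same-colour-congruent u v same = begin
    u - v
      ≡⟨ cong₂ _-_ (expansion u) expansion-v ⟩
    (+ r + (+ s + cycle u * + 2 ^ r) * + L) - (+ r + (+ s + cycle v * + 2 ^ r) * + L)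
      ≡⟨ difference-of-expansions (+ r) (+ s) (+ 2 ^ r) (+ L) (cycle u) (cycle v) ⟩
    (cycle u - cycle v) * (+ 2 ^ r * + L)
      ≡⟨ cong ((cycle u - cycle v) *_) (sym (ℤP.pos-* (2 ^ r) L)) ⟩
    (cycle u - cycle v) * + (2 ^ r ℕ.* L)
      ∎
    where
    open ≡-Reasoning
    r = level u
    s = offset u
    expansion-v : v ≡ + r + (+ s + cycle v * + 2 ^ r) * + L
    expansion-v = subst₂ (λ r' s' → v ≡ + r' + (+ s' + cycle v * + 2 ^ r') * + L)
                         (sym (colour-determines-level u v same))
                         (sym (colour-determines-offset u v same))
                         (expansion v)
    difference-of-expansions : ∀ a b P X k k' →
      (a + (b + k * P) * X) - (a + (b + k' * P) * X) ≡ (k - k') * (P * X)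
    difference-of-expansions = ℤSolver.solve-∀

  same-colour-apart : ∀ u v → ¬ u ≡ v → colour u ≡ colour v →
                      2 ^ level u ℕ.* L ≤ ∣ u - v ∣
  same-colour-apart u v u≢v same =
    multiple-apart u v (2 ^ level u ℕ.* L) (cycle u - cycle v) u≢v
                   (same-colour-congruent u v same)

period : ℕ → ℕ
period B = 2 ℕ.* suc B

-- If every element of D is at most B, the colouring with period 2(B+1) is a
-- packing colouring of G(ℤ, D): a short walk between two equally coloured
-- vertices would bring them closer than 'same-colour-apart' allows.
bounded-packing-colouring : ∀ D B → (∀ {d} → d ∈ D → d ≤ B) →
                            IsPackingColoring D (2 ^ period B) (Colouring.colour (period B))
bounded-packing-colouring D B bounded = colour-range , packing
  where
  open Colouring (period B)
  M = suc B
  packing : ∀ u v → ¬ u ≡ v → colour u ≡ colour v → DistGE D u v (suc (colour u))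
  packing u v u≢v same n n<1+c walk =
    ℕP.<-irrefl refl (ℕP.<-≤-trans too-close (same-colour-apart u v u≢v same))
    where
    open ℕP.≤-Reasoning
    r = level u
    regroup : ∀ a m → (2 ℕ.* a) ℕ.* m ≡ a ℕ.* (2 ℕ.* m)
    regroup = ℕSolver.solve-∀
    too-close : ∣ u - v ∣ < 2 ^ r ℕ.* period B
    too-close = begin-strict
      ∣ u - v ∣        ≡⟨ ℤP.∣i-j∣≡∣j-i∣ u v ⟩
      ∣ v - u ∣        ≤⟨ walk-displacement (λ d∈D → ℕP.m≤n⇒m≤1+n (bounded d∈D)) walk ⟩
      n ℕ.* M          ≤⟨ ℕP.*-monoˡ-≤ M (ℕ.s≤s⁻¹ n<1+c) ⟩
      colour u ℕ.* M   <⟨ ℕP.*-monoˡ-< M (colour<2^[1+level] u) ⟩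
      2 ^ suc r ℕ.* M  ≡⟨ regroup (2 ^ r) M ⟩
      2 ^ r ℕ.* period B ∎

-- Corollary 1: χ_ρ(G(ℤ, D)) ≤ 2^(2(max D + 1)).
corollary1 : (D : List ℕ) → PositiveSet D → PackingChromaticFinite D
corollary1 D _ = 2 ^ period B , Colouring.colour (period B) ,
                 bounded-packing-colouring D B (All.lookup (xs≤max 0 D))
  where
  B = max 0 D
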